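{- Let $N=\{1,\ldots,n\}$ and let $A,B$ be $n\times n$ $0,1$-matrices with $AB=J$ (the all-ones matrix). Let $(N,*)$ be the associated groupoid: $a*b$ is the unique $c\in N$ with $A_{ac}=1$ and $B_{cb}=1$. Then $BA=J$ if and only if there is a binary operation $+$ on $N$ such that the algebra $(N,*,+)$ satisfies, for all $a,b,c\in N$, \[(a*b)+(b*c)=b\quad\text{and}\quad (a+b)*(b+c)=b.\]
   Context: $J$ denotes the $n\times n$ matrix all of whose entries are $1$. Since $AB=J$, for all $a,b$ there is exactly one $c$ with $A_{ac}=B_{cb}=1$, so $*$ is well defined. -}

module Defs where

open import Data.Nat using (ℕ; _+_; _*_)
open import Data.Fin using (Fin)
open import Data.Vec.Functional using (foldr)
open import Relation.Binary.PropositionalEquality using (_≡_)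
open import Data.Product using (_×_)

Mat : ℕ → Set
Mat n = Fin n → Fin n → ℕ

∑ : ∀ {n} → (Fin n → ℕ) → ℕ
∑ {n} f = foldr _+_ 0 f

_·_ : ∀ {n} → Mat n → Mat n → Mat n
(A · B) i j = ∑ (λ k → A i k * B k j)

J : ∀ n → Mat n
J n i j = 1

data Bit : ℕ → Set where
  bit0 : Bit 0
  bit1 : Bit 1

Is01 : ∀ {n} → Mat n → Set
Is01 {n} A = ∀ i j → Bit (A i j)

_≐_ : ∀ {n} → Mat n → Mat n → Set
A ≐ B = ∀ i j → A i j ≡ B i j

-- star is the groupoid operation of (A,B): a * b is a c with A a c = 1 and B c b = 1
-- (when A·B = J such c exists and is unique, so star is the associated groupoid)
IsAssocGroupoid : ∀ {n} → Mat n → Mat n → (Fin n → Fin n → Fin n) → Set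
IsAssocGroupoid A B _*_ = ∀ a b → A a (a * b) ≡ 1 × B (a * b) b ≡ 1

module Submission where

-- For 0,1-matrices X and Y call k a *middle* of (X,Y) from i
-- to j when X i k = 1 = Y k j; the entry (X·Y) i j counts these middles.
-- So X·Y = J says every pair (i,j) has exactly one middle, and an operation
-- with IsAssocGroupoid X Y is precisely the choice of that middle.
--
-- (⇒) If B·A = J, the groupoid _+_ of (B,A) exists.  Both identities are
--     instances of one absorption law: b is a middle of (Y,X) from a*b to
--     b*c, so uniqueness of middles of Y·X = J gives (a*b)+(b*c) = b; with
--     (X,Y) = (A,B) this is the first identity, with (X,Y) = (B,A) the second.
-- (⇐) The second identity forces _+_ to pick a middle of (B,A) from c to d,
--     and the first one, together with uniqueness of middles of A·B = J,
--     shows that every such middle k equals c + d.  Hence (B·A) c d = 1.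

open import Defs
open import Data.Nat using (ℕ)
open import Data.Fin using (Fin)
open import Data.Product using (Σ; _×_)
open import Relation.Binary.PropositionalEquality using (_≡_)
open import Function.Bundles using (_⇔_)

import Data.Nat as Nat
open import Data.Nat using (zero; suc; _≤_; s≤s)
open import Data.Nat.Properties
  using (+-comm; ≤-trans; m≤m+n; m≤n+m; +-monoʳ-≤; m*n≡1⇒m≡1; m*n≡1⇒n≡1)
open import Data.Fin using (zero; suc)
open import Data.Fin.Properties using (suc-injective; _≟_)
open import Data.Product using (_,_; proj₁; proj₂)
open import Data.Sum using (_⊎_; inj₁; inj₂)
open import Data.Empty using (⊥-elim)
open import Function using (_∘_; mk⇔)
open import Relation.Nullary using (¬_; yes; no)
open import Relation.Binary.PropositionalEquality using (_≢_; refl; sym; cong; cong₂; subst; subst₂; module ≡-Reasoning)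

term≤∑ : ∀ {n} (f : Fin n → ℕ) (k : Fin n) → f k ≤ ∑ f
term≤∑ f zero    = m≤m+n (f zero) _
term≤∑ f (suc k) = ≤-trans (term≤∑ (f ∘ suc) k) (m≤n+m _ (f zero))

pair≤∑ : ∀ {n} (f : Fin n → ℕ) {i j : Fin n} → i ≢ j → f i Nat.+ f j ≤ ∑ f
pair≤∑ f {zero}  {zero}  i≢j = ⊥-elim (i≢j refl)
pair≤∑ f {zero}  {suc j} _   = +-monoʳ-≤ (f zero) (term≤∑ (f ∘ suc) j)
pair≤∑ f {suc i} {zero}  _   =
  subst (_≤ ∑ f) (+-comm (f zero) (f (suc i))) (+-monoʳ-≤ (f zero) (term≤∑ (f ∘ suc) i))
pair≤∑ f {suc i} {suc j} i≢j =
  ≤-trans (pair≤∑ (f ∘ suc) (i≢j ∘ cong suc)) (m≤n+m _ (f zero))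

∑≡1⇒unique : ∀ {n} (f : Fin n → ℕ) → ∑ f ≡ 1 → ∀ {i j} → f i ≡ 1 → f j ≡ 1 → i ≡ j
∑≡1⇒unique f s {i} {j} fi fj with i ≟ j
... | yes i≡j = i≡j
... | no  i≢j = ⊥-elim (two≰one (subst₂ _≤_ (cong₂ Nat._+_ fi fj) s (pair≤∑ f i≢j)))
  where
  two≰one : ¬ (2 ≤ 1)
  two≰one (s≤s ())

∑≡1⇒witness : ∀ {n} (f : Fin n → ℕ) → ∑ f ≡ 1 → Σ (Fin n) (λ k → f k ≡ 1)
∑≡1⇒witness {suc n} f s with f zero in f₀
... | 0 = let k , fk = ∑≡1⇒witness (f ∘ suc) s in suc k , fk
... | 1 = zero , f₀

∑-zero : ∀ {n} (f : Fin n → ℕ) → (∀ k → f k ≡ 0) → ∑ f ≡ 0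
∑-zero {zero}  f _    = refl
∑-zero {suc n} f all0 = cong₂ Nat._+_ (all0 zero) (∑-zero (f ∘ suc) (all0 ∘ suc))

∑-single : ∀ {n} (f : Fin n → ℕ) {m : Fin n} → f m ≡ 1 → (∀ k → k ≢ m → f k ≡ 0) → ∑ f ≡ 1
∑-single {suc n} f {zero}  fm others =
  cong₂ Nat._+_ fm (∑-zero (f ∘ suc) (λ k → others (suc k) λ ()))
∑-single {suc n} f {suc m} fm others =
  cong₂ Nat._+_ (others zero λ ())
    (∑-single (f ∘ suc) fm (λ k k≢m → others (suc k) (k≢m ∘ suc-injective)))

Middle : ∀ {n} → Mat n → Mat n → Fin n → Fin n → Fin n → Set
Middle X Y i j k = X i k ≡ 1 × Y k j ≡ 1

middle-term : ∀ {n} (X Y : Mat n) {i j k} → Middle X Y i j k → X i k Nat.* Y k j ≡ 1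
middle-term X Y (Xik , Ykj) = cong₂ Nat._*_ Xik Ykj

middle-unique : ∀ {n} (X Y : Mat n) {i j k l} → (X · Y) i j ≡ 1 →
  Middle X Y i j k → Middle X Y i j l → k ≡ l
middle-unique X Y {i} {j} XY k-mid l-mid =
  ∑≡1⇒unique (λ k → X i k Nat.* Y k j) XY (middle-term X Y k-mid) (middle-term X Y l-mid)

middle-exists : ∀ {n} (X Y : Mat n) {i j} → (X · Y) i j ≡ 1 → Σ (Fin n) (Middle X Y i j)
middle-exists X Y {i} {j} XY =
  let k , term = ∑≡1⇒witness (λ k → X i k Nat.* Y k j) XY
  in k , m*n≡1⇒m≡1 (X i k) (Y k j) term , m*n≡1⇒n≡1 (X i k) (Y k j) term

bit-product : ∀ {a b} → Bit a → Bit b → a Nat.* b ≡ 0 ⊎ (a ≡ 1 × b ≡ 1)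
bit-product bit0 _    = inj₁ refl
bit-product bit1 bit0 = inj₁ refl
bit-product bit1 bit1 = inj₂ (refl , refl)

unique-middle⇒product≡1 : ∀ {n} (X Y : Mat n) → Is01 X → Is01 Y → ∀ {i j m} →
  Middle X Y i j m → (∀ k → Middle X Y i j k → k ≡ m) → (X · Y) i j ≡ 1
unique-middle⇒product≡1 X Y X01 Y01 {i} {j} m-mid only-m =
  ∑-single (λ k → X i k Nat.* Y k j) (middle-term X Y m-mid) vanishing
  where
  vanishing : ∀ k → k ≢ _ → X i k Nat.* Y k j ≡ 0
  vanishing k k≢m with bit-product (X01 i k) (Y01 k j)
  ... | inj₁ zero-term = zero-term
  ... | inj₂ k-mid     = ⊥-elim (k≢m (only-m k k-mid))

groupoid-exists : ∀ {n} (X Y : Mat n) → (X · Y) ≐ J n →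
  Σ (Fin n → Fin n → Fin n) (IsAssocGroupoid X Y)
groupoid-exists X Y XY =
  (λ a b → proj₁ (middle-exists X Y (XY a b))) , (λ a b → proj₂ (middle-exists X Y (XY a b)))

groupoid-middle : ∀ {n} (X Y : Mat n) {_*_ : Fin n → Fin n → Fin n} → (X · Y) ≐ J n →
  IsAssocGroupoid X Y _*_ → ∀ {a b c} → Middle X Y a b c → c ≡ a * b
groupoid-middle X Y XY G {a} {b} c-mid = middle-unique X Y (XY a b) c-mid (G a b)

-- Absorption: for groupoids _*_ of (X,Y) and _+_ of (Y,X) with Y · X = J,
-- b is the middle of (Y,X) from a * b to b * c, hence (a * b) + (b * c) = b.
absorption : ∀ {n} (X Y : Mat n) {_*_ _+_ : Fin n → Fin n → Fin n} → (Y · X) ≐ J n →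
  IsAssocGroupoid X Y _*_ → IsAssocGroupoid Y X _+_ → ∀ a b c → (a * b) + (b * c) ≡ b
absorption X Y YX G* G+ a b c =
  sym (groupoid-middle Y X YX G+ (proj₂ (G* a b) , proj₁ (G* b c)))

-- If (a + b) * (b + c) = b for a groupoid _*_ of (X,Y), then _+_ is a groupoid of (Y,X):
-- a is the *-product of a + a and a + b, and b that of a + b and b + b.
dual-groupoid : ∀ {n} (X Y : Mat n) {_*_ _+_ : Fin n → Fin n → Fin n} →
  IsAssocGroupoid X Y _*_ → (∀ a b c → (a + b) * (b + c) ≡ b) → IsAssocGroupoid Y X _+_
dual-groupoid X Y {_*_} {_+_} G law a b =
  subst (λ z → Y z (a + b) ≡ 1) (law a a b) (proj₂ (G (a + a) (a + b))) ,
  subst (λ z → X (a + b) z ≡ 1) (law a b b) (proj₁ (G (a + b) (b + b)))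

-- With X · Y = J, groupoids _*_ of (X,Y) and _+_ of (Y,X) and the absorption law,
-- every middle k of (Y,X) from c to d equals c + d:
-- uniqueness of *-middles gives c = (c + c) * k and d = k * (d + d), and
-- absorption turns ((c + c) * k) + (k * (d + d)) into k.
middle-is-sum : ∀ {n} (X Y : Mat n) {_*_ _+_ : Fin n → Fin n → Fin n} → (X · Y) ≐ J n →
  IsAssocGroupoid X Y _*_ → IsAssocGroupoid Y X _+_ → (∀ a b c → (a * b) + (b * c) ≡ b) →
  ∀ {c d k} → Middle Y X c d k → k ≡ c + d
middle-is-sum X Y {_*_} {_+_} XY G* G+ absorb {c} {d} {k} (Yck , Xkd) = begin
  k                               ≡⟨ sym (absorb (c + c) k (d + d)) ⟩
  ((c + c) * k) + (k * (d + d))   ≡⟨ cong₂ _+_ (sym c≡[c+c]*k) (sym d≡k*[d+d]) ⟩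
  c + d                           ∎
  where
  open ≡-Reasoning
  c≡[c+c]*k : c ≡ (c + c) * k
  c≡[c+c]*k = groupoid-middle X Y XY G* (proj₂ (G+ c c) , Yck)
  d≡k*[d+d] : d ≡ k * (d + d)
  d≡k*[d+d] = groupoid-middle X Y XY G* (Xkd , proj₁ (G+ d d))

mainTheorem6 : (n : ℕ) (A B : Mat n) → Is01 A → Is01 B → (A · B) ≐ J n →
    (_*_ : Fin n → Fin n → Fin n) → IsAssocGroupoid A B _*_ →
    ((B · A) ≐ J n ⇔ Σ (Fin n → Fin n → Fin n) (λ _+_ → ∀ a b c → ((a * b) + (b * c) ≡ b) × ((a + b) * (b + c) ≡ b)))
mainTheorem6 n A B A01 B01 AB _*_ G* = mk⇔ to from
  where
  Op : Set
  Op = Fin n → Fin n → Fin n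

  Laws : Op → Set
  Laws _+_ = ∀ a b c → ((a * b) + (b * c) ≡ b) × ((a + b) * (b + c) ≡ b)

  to : (B · A) ≐ J n → Σ Op Laws
  to BA = let _+_ , G+ = groupoid-exists B A BA in
    _+_ , λ a b c → absorption A B BA G* G+ a b c , absorption B A AB G+ G* a b c

  from : Σ Op Laws → (B · A) ≐ J n
  from (_+_ , laws) c d =
    unique-middle⇒product≡1 B A B01 A01 (G+ c d) (λ _ → middle-is-sum A B AB G* G+ absorb)
    where
    absorb : ∀ a b c → (a * b) + (b * c) ≡ b
    absorb a b c = proj₁ (laws a b c)
    G+ : IsAssocGroupoid B A _+_
    G+ = dual-groupoid A B G* (λ a b c → proj₂ (laws a b c))
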